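{- Let $G=(V,E)$ be a connected graph, let $\widehat G=(V,E\cup F)$ with $F\subseteq\binom{V}{2}\setminus E$, and let $E'\subseteq E\cup F$ be such that $G'=(V,E')$ is connected. Then $\mathrm{LMC}(G',\widehat G)\subseteq \mathrm{LMC}(G,\widehat G)$ if and only if $E'\subseteq E$.
   Context: Graphs are finite, simple, undirected. For a connected graph $H=(V,E_H)$ with $E_H\subseteq E\cup F$, a decomposition of $H$ is a partition $\Pi$ of $V$ such that each block induces a connected subgraph of $H$. For such $\Pi$, the multicut of $\widehat G$ lifted from $H$ induced by $\Pi$ is the set of edges of $E\cup F$ whose endpoints lie in distinct blocks of $\Pi$. $\mathrm{LMC}(H,\widehat G)\subseteq\mathbb{R}^{E\cup F}$ is the convex hull of the characteristic vectors of all multicuts of $\widehat G$ lifted from $H$.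
   Formalization: The polytopes $\mathrm{LMC}(G',\widehat G)$ and $\mathrm{LMC}(G,\widehat G)$ are taken over ℚ: their points have rational coordinates and are convex combinations with rational coefficients, rather than points of $\mathbb{R}^{E\cup F}$. -}

module Defs where

open import Data.Bool using (Bool; true; false; _∨_)
open import Data.Fin using (Fin; _≟_)
open import Data.Nat using (ℕ)
open import Data.List using (List; map)
open import Data.List.Relation.Unary.All using (All)
open import Data.Product using (_×_; _,_; proj₁; ∃)
open import Data.Rational using (ℚ; 0ℚ; 1ℚ; _*_; _≤_)
open import Data.Rational.Properties using ()
open import Data.Unit using (⊤)
open import Relation.Nullary.Decidable using (does)
open import Relation.Binary.PropositionalEquality using (_≡_)

-- Vertex set V = Fin n.  An edge set is a Boolean adjacency relation on V;
-- an unordered edge {u,v} is represented by both ordered pairs (u,v), (v,u).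
EdgeSet : ℕ → Set
EdgeSet n = Fin n → Fin n → Bool

record Simple {n : ℕ} (E : EdgeSet n) : Set where
  field
    sym   : ∀ u v → E u v ≡ true → E v u ≡ true
    irrefl : ∀ u → E u u ≡ false

_∪E_ : ∀ {n} → EdgeSet n → EdgeSet n → EdgeSet n
(E ∪E F) u v = E u v ∨ F u v

_⊆E_ : ∀ {n} → EdgeSet n → EdgeSet n → Set
E ⊆E F = ∀ u v → E u v ≡ true → F u v ≡ true

data WalkIn {n : ℕ} (H : EdgeSet n) (P : Fin n → Set) : Fin n → Fin n → Set where
  here : ∀ {u} → P u → WalkIn H P u u
  step : ∀ {u w v} → P u → H u w ≡ true → WalkIn H P w v → WalkIn H P u v

Connected : ∀ {n} → EdgeSet n → Set
Connected {n} H = ∀ u v → WalkIn H (λ _ → ⊤) u v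

-- A partition of V is given by a block-labelling lab : V → Fin n
-- (blocks = nonempty fibres; every partition of V arises this way).
Labelling : ℕ → Set
Labelling n = Fin n → Fin n

IsDecomposition : ∀ {n} → EdgeSet n → Labelling n → Set
IsDecomposition H lab =
  ∀ u v → lab u ≡ lab v → WalkIn H (λ w → lab w ≡ lab u) u v

-- Characteristic vector of the induced (lifted) multicut, evaluated at the
-- pair (u,v): 1 if u,v are in distinct blocks, 0 otherwise.  (Only read off
-- on edges of E ∪ F.)
χ : ∀ {n} → Labelling n → Fin n → Fin n → ℚ
χ lab u v with does (lab u ≟ lab v)
... | true  = 0ℚ
... | false = 1ℚ

sumℚ : List ℚ → ℚ
sumℚ = Data.List.foldr Data.Rational._+_ 0ℚ

-- Vectors in ℚ^{E ∪ F}: functions on pairs, only coordinates (u,v) with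
-- Ĝ u v ≡ true are relevant.
-- x ∈ LMC(H, Ĝ): x is a convex combination of characteristic vectors of
-- multicuts of Ĝ lifted from H.
InLMC : ∀ {n} → EdgeSet n → EdgeSet n → (Fin n → Fin n → ℚ) → Set
InLMC {n} H Ĝ x =
  ∃ λ (cs : List (ℚ × Labelling n)) →
      All (λ p → (0ℚ ≤ proj₁ p) × IsDecomposition H (Data.Product.proj₂ p)) cs
    × sumℚ (map proj₁ cs) ≡ 1ℚ
    × (∀ u v → Ĝ u v ≡ true →
         x u v ≡ sumℚ (map (λ p → proj₁ p * χ (Data.Product.proj₂ p) u v) cs))

_⊆LMC_within_ : ∀ {n} → EdgeSet n → EdgeSet n → EdgeSet n → Set
_⊆LMC_within_ {n} H₁ H₂ Ĝ = ∀ (x : Fin n → Fin n → ℚ) → InLMC H₁ Ĝ x → InLMC H₂ Ĝ x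

{-# OPTIONS --safe #-}
-- If E′ ⊆ E, every decomposition of G′ is a decomposition of G, so the
-- inclusion of polytopes is immediate.  Conversely, let uv ∈ E′ ∖ E and let x
-- be the multicut of the decomposition of G′ whose only non-singleton block is
-- {u, v}: then x_uv = 0 and x_uw = 1 for every G-neighbour w of u.  Writing x
-- as a convex combination of multicuts lifted from G, every decomposition of
-- positive weight must join u and v yet separate u from all its G-neighbours;
-- but a block of G that is connected and contains u ≠ v contains a
-- G-neighbour of u.  Hence all weights vanish, contradicting that they sum
-- to 1.
module Submission where

open import Defs
open import Data.Nat using (ℕ)
open import Data.Bool using (true; false)
open import Function.Bundles using (_⇔_)
open import Relation.Binary.PropositionalEquality using (_≡_)

open import Data.Bool using (if_then_else_)
open import Data.Fin using (Fin; _≟_)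
open import Data.List using ([]; _∷_; map)
open import Data.List.Membership.Propositional using (_∈_)
open import Data.List.Relation.Unary.All as All using (All; []; _∷_)
open import Data.Product using (_×_; _,_; proj₁; proj₂; ∃)
open import Data.Empty using (⊥-elim)
open import Data.Rational using (ℚ; 0ℚ; 1ℚ; _*_; _+_; _≤_)
open import Data.Rational.Properties
  using (≤-antisym; ≤-refl; ≤-reflexive; ≮⇒≥; <⇒≢; +-mono-≤; +-mono-<-≤; +-mono-≤-<;
         +-identityʳ; *-identityˡ; *-identityʳ; *-zeroʳ; nonNegative⁻¹)
open import Function using (_∘_; const; case_of_)
open import Function.Bundles using (mk⇔)
open import Relation.Nullary using (yes; no)
open import Relation.Nullary.Decidable using (does)
open import Relation.Binary.PropositionalEquality
  using (refl; sym; trans; cong; cong₂; subst; _≢_; module ≡-Reasoning)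

open ≡-Reasoning

+-tight : ∀ {a b c d : ℚ} → a ≤ c → b ≤ d → a + b ≡ c + d → a ≡ c × b ≡ d
+-tight a≤c b≤d eq =
  ≤-antisym a≤c (≮⇒≥ λ a<c → <⇒≢ (+-mono-<-≤ a<c b≤d) eq) ,
  ≤-antisym b≤d (≮⇒≥ λ b<d → <⇒≢ (+-mono-≤-< a≤c b<d) eq)

module _ {a} {A : Set a} where

  sumℚ-map-≡0 : ∀ {f : A → ℚ} {xs} →
    All (λ x → f x ≡ 0ℚ) xs → sumℚ (map f xs) ≡ 0ℚ
  sumℚ-map-≡0 []            = refl
  sumℚ-map-≡0 (fx≡0 ∷ f≡0) = trans (cong₂ _+_ fx≡0 (sumℚ-map-≡0 f≡0)) (+-identityʳ 0ℚ)

  sumℚ-map-mono : ∀ {f g : A → ℚ} {xs} →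
    All (λ x → f x ≤ g x) xs → sumℚ (map f xs) ≤ sumℚ (map g xs)
  sumℚ-map-mono []            = ≤-refl
  sumℚ-map-mono (fx≤gx ∷ f≤g) = +-mono-≤ fx≤gx (sumℚ-map-mono f≤g)

  sumℚ-map-tight : ∀ {f g : A → ℚ} {xs} → All (λ x → f x ≤ g x) xs →
    sumℚ (map f xs) ≡ sumℚ (map g xs) → All (λ x → f x ≡ g x) xs
  sumℚ-map-tight []            _  = []
  sumℚ-map-tight (fx≤gx ∷ f≤g) eq =
    let fx≡gx , rest = +-tight fx≤gx (sumℚ-map-mono f≤g) eq
    in  fx≡gx ∷ sumℚ-map-tight f≤g rest

  sumℚ-map-nonneg-≡0 : ∀ {f : A → ℚ} {xs} → All (λ x → 0ℚ ≤ f x) xs →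
    sumℚ (map f xs) ≡ 0ℚ → All (λ x → f x ≡ 0ℚ) xs
  sumℚ-map-nonneg-≡0 {xs = xs} 0≤f eq = All.map sym (sumℚ-map-tight 0≤f (begin
    sumℚ (map (const 0ℚ) xs) ≡⟨ sumℚ-map-≡0 (All.universal (λ _ → refl) xs) ⟩
    0ℚ                       ≡⟨ sym eq ⟩
    _                        ∎))

module _ {n : ℕ} where

  Simple⇒≢ : ∀ {H : EdgeSet n} {u v} → Simple H → H u v ≡ true → u ≢ v
  Simple⇒≢ sH uv refl = case trans (sym uv) (Simple.irrefl sH _) of λ ()

  walk-source : ∀ {H : EdgeSet n} {P a b} → WalkIn H P a b → P a
  walk-source (here pa)     = pa
  walk-source (step pa _ _) = pa

  walk-first-step : ∀ {H : EdgeSet n} {P a b} → a ≢ b → WalkIn H P a b →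
    ∃ λ w → H a w ≡ true × P w
  walk-first-step a≢a (here _)          = ⊥-elim (a≢a refl)
  walk-first-step _   (step _ aw walk) = _ , aw , walk-source walk

  WalkIn-mono : ∀ {H H′ : EdgeSet n} {P a b} → H ⊆E H′ → WalkIn H P a b → WalkIn H′ P a b
  WalkIn-mono H⊆H′ (here pa)         = here pa
  WalkIn-mono H⊆H′ (step pa aw walk) = step pa (H⊆H′ _ _ aw) (WalkIn-mono H⊆H′ walk)

  IsDecomposition-mono : ∀ {H H′ : EdgeSet n} {lab} → H ⊆E H′ →
    IsDecomposition H lab → IsDecomposition H′ lab
  IsDecomposition-mono H⊆H′ dec a b a∼b = WalkIn-mono H⊆H′ (dec a b a∼b)

  adjacent-blocks⇒IsDecomposition : ∀ {H : EdgeSet n} {lab : Labelling n} →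
    (∀ a b → a ≢ b → lab a ≡ lab b → H a b ≡ true) → IsDecomposition H lab
  adjacent-blocks⇒IsDecomposition adjacent a b a∼b with a ≟ b
  ... | yes refl = here refl
  ... | no  a≢b  = step refl (adjacent a b a≢b a∼b) (here (sym a∼b))

  neighbour-in-block : ∀ {H : EdgeSet n} {lab : Labelling n} {u v} →
    IsDecomposition H lab → u ≢ v → lab u ≡ lab v → ∃ λ w → H u w ≡ true × lab w ≡ lab u
  neighbour-in-block dec u≢v u∼v = walk-first-step u≢v (dec _ _ u∼v)

  χ-same : ∀ (lab : Labelling n) a b → lab a ≡ lab b → χ lab a b ≡ 0ℚ
  χ-same lab a b a∼b with lab a ≟ lab b
  ... | yes _   = refl
  ... | no  a≁b = ⊥-elim (a≁b a∼b)

  χ-distinct : ∀ (lab : Labelling n) a b → lab a ≢ lab b → χ lab a b ≡ 1ℚ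
  χ-distinct lab a b a≁b with lab a ≟ lab b
  ... | yes a∼b = ⊥-elim (a≁b a∼b)
  ... | no  _   = refl

  0≤*χ : ∀ {c} (lab : Labelling n) a b → 0ℚ ≤ c → 0ℚ ≤ c * χ lab a b
  0≤*χ {c} lab a b 0≤c with lab a ≟ lab b
  ... | yes _ = ≤-reflexive (sym (*-zeroʳ c))
  ... | no  _ = subst (0ℚ ≤_) (sym (*-identityʳ c)) 0≤c

  *χ≤ : ∀ {c} (lab : Labelling n) a b → 0ℚ ≤ c → c * χ lab a b ≤ c
  *χ≤ {c} lab a b 0≤c with lab a ≟ lab b
  ... | yes _ = subst (_≤ c) (sym (*-zeroʳ c)) 0≤c
  ... | no  _ = ≤-reflexive (*-identityʳ c)

  χ∈LMC : ∀ {H Ĝ : EdgeSet n} {lab} → IsDecomposition H lab → InLMC H Ĝ (χ lab)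
  χ∈LMC {lab = lab} dec =
    (1ℚ , lab) ∷ [] , (nonNegative⁻¹ 1ℚ , dec) ∷ [] , refl ,
    λ a b _ → sym (trans (+-identityʳ _) (*-identityˡ _))

  ⊆E⇒⊆LMC : ∀ {H H′ Ĝ : EdgeSet n} → H′ ⊆E H → H′ ⊆LMC H within Ĝ
  ⊆E⇒⊆LMC H′⊆H x (cs , valid , total , x≡) =
    cs , All.map (λ (0≤c , dec) → 0≤c , IsDecomposition-mono H′⊆H dec) valid , total , x≡

  pairBlock : Fin n → Fin n → Labelling n
  pairBlock u v w = if does (w ≟ v) then u else w

  pairBlock-v : ∀ {u v} → pairBlock u v v ≡ u
  pairBlock-v {v = v} with v ≟ v
  ... | yes _   = refl
  ... | no  v≢v = ⊥-elim (v≢v refl)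

  pairBlock-≢ : ∀ {u v w} → w ≢ v → pairBlock u v w ≡ w
  pairBlock-≢ {v = v} {w} w≢v with w ≟ v
  ... | yes w≡v = ⊥-elim (w≢v w≡v)
  ... | no  _   = refl

  pairBlock-joins : ∀ {u v} → u ≢ v → pairBlock u v u ≡ pairBlock u v v
  pairBlock-joins {u} {v} u≢v = trans (pairBlock-≢ u≢v) (sym (pairBlock-v {u} {v}))

  pairBlock-separates : ∀ {u v w} → u ≢ v → w ≢ u → w ≢ v →
    pairBlock u v u ≢ pairBlock u v w
  pairBlock-separates u≢v w≢u w≢v u∼w =
    w≢u (sym (trans (sym (pairBlock-≢ u≢v)) (trans u∼w (pairBlock-≢ w≢v))))

  pairBlock-IsDecomposition : ∀ {H : EdgeSet n} {u v} → Simple H → H u v ≡ true →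
    IsDecomposition H (pairBlock u v)
  pairBlock-IsDecomposition {H} {u} {v} sH uv = adjacent-blocks⇒IsDecomposition adjacent
    where
    adjacent : ∀ a b → a ≢ b → pairBlock u v a ≡ pairBlock u v b → H a b ≡ true
    adjacent a b a≢b a∼b with a ≟ v | b ≟ v
    ... | yes refl | yes refl = ⊥-elim (a≢b refl)
    ... | no  _    | no  _    = ⊥-elim (a≢b a∼b)
    adjacent a b _ refl | yes refl | no _ = Simple.sym sH u v uv
    adjacent a b _ refl | no _ | yes refl = uv

  joined-isolated-weight≡0 : ∀ {H : EdgeSet n} {lab c u v} → IsDecomposition H lab → u ≢ v →
    c * χ lab u v ≡ 0ℚ → (∀ w → H u w ≡ true → c * χ lab u w ≡ c) → c ≡ 0ℚ
  joined-isolated-weight≡0 {lab = lab} {c} {u} {v} dec u≢v joined isolated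
    with lab u ≟ lab v
  ... | no  _   = trans (sym (*-identityʳ c)) joined
  ... | yes u∼v with neighbour-in-block dec u≢v u∼v
  ... | w , uw , w∼u = begin
    c               ≡⟨ sym (isolated w uw) ⟩
    c * χ lab u w   ≡⟨ cong (c *_) (χ-same lab u w (sym w∼u)) ⟩
    c * 0ℚ          ≡⟨ *-zeroʳ c ⟩
    0ℚ              ∎

  isolated-vertex-not-joined : ∀ {H Ĝ : EdgeSet n} {x u v} → InLMC H Ĝ x → H ⊆E Ĝ →
    Ĝ u v ≡ true → u ≢ v → (∀ w → H u w ≡ true → x u w ≡ 1ℚ) → x u v ≢ 0ℚ
  isolated-vertex-not-joined {H} {u = u} {v} (cs , valid , total , x≡) H⊆Ĝ uv u≢v
    isolated joined =
    case trans (sym total) (sumℚ-map-≡0 (All.tabulate vanishes)) of λ ()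
    where
    joins : All (λ (c , lab) → c * χ lab u v ≡ 0ℚ) cs
    joins = sumℚ-map-nonneg-≡0 (All.map (λ {p} (0≤c , _) → 0≤*χ (proj₂ p) u v 0≤c) valid)
              (trans (sym (x≡ u v uv)) joined)

    separates : ∀ w → H u w ≡ true → All (λ (c , lab) → c * χ lab u w ≡ c) cs
    separates w uw =
      sumℚ-map-tight (All.map (λ {p} (0≤c , _) → *χ≤ (proj₂ p) u w 0≤c) valid)
      (trans (sym (x≡ u w (H⊆Ĝ u w uw))) (trans (isolated w uw) (sym total)))

    vanishes : ∀ {p} → p ∈ cs → proj₁ p ≡ 0ℚ
    vanishes p∈cs =
      joined-isolated-weight≡0 (proj₂ (All.lookup valid p∈cs)) u≢v (All.lookup joins p∈cs)
        λ w uw → All.lookup (separates w uw) p∈cs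

  ⊆LMC⇒⊆E : ∀ {H H′ Ĝ : EdgeSet n} → Simple H → Simple H′ → H ⊆E Ĝ → H′ ⊆E Ĝ →
    H′ ⊆LMC H within Ĝ → H′ ⊆E H
  ⊆LMC⇒⊆E {H} {Ĝ = Ĝ} sH sH′ H⊆Ĝ H′⊆Ĝ incl u v uv′ with H u v in uv
  ... | true  = refl
  ... | false =
    ⊥-elim (isolated-vertex-not-joined x∈LMC H⊆Ĝ (H′⊆Ĝ u v uv′) u≢v isolated joined)
    where
    u≢v : u ≢ v
    u≢v = Simple⇒≢ sH′ uv′

    x∈LMC : InLMC H Ĝ (χ (pairBlock u v))
    x∈LMC = incl _ (χ∈LMC (pairBlock-IsDecomposition sH′ uv′))

    joined : χ (pairBlock u v) u v ≡ 0ℚ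
    joined = χ-same (pairBlock u v) u v (pairBlock-joins u≢v)

    isolated : ∀ w → H u w ≡ true → χ (pairBlock u v) u w ≡ 1ℚ
    isolated w uw = χ-distinct (pairBlock u v) u w
      (pairBlock-separates u≢v (Simple⇒≢ sH uw ∘ sym) λ { refl →
        case trans (sym uw) uv of λ () })

proposition5p3 : (n : ℕ) (E F E′ : EdgeSet n) →
    Simple E → Simple F → (∀ u v → F u v ≡ true → E u v ≡ false) →
    Connected E →
    Simple E′ → E′ ⊆E (E ∪E F) → Connected E′ →
    ((E′ ⊆LMC E within (E ∪E F)) ⇔ (E′ ⊆E E))
proposition5p3 n E F E′ sE _ _ _ sE′ E′⊆Ĝ _ =
  mk⇔ (⊆LMC⇒⊆E sE sE′ E⊆Ĝ E′⊆Ĝ) ⊆E⇒⊆LMC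
  where
  E⊆Ĝ : E ⊆E (E ∪E F)
  E⊆Ĝ u v uv rewrite uv = refl
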